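{- Let $G$ be a finite group and $M$ a $\mathbb{Z}[G]$-module. (1) If $G$ admits a scalar norm relation $d=\sum_{i=1}^\ell a_iN_{H_i}$ with $H_i\le G$, $d\in\mathbb{Z}_{>0}$, $a_i\in\mathbb{Z}$, then the quotient $M/\sum_{i=1}^\ell M^{H_i}$ has finite exponent dividing $d$. (2) If $G$ admits a norm relation $d=\sum_{i=1}^\ell a_iN_{H_i}b_i$ with $H_i\le G$, $d\in\mathbb{Z}_{>0}$, $a_i,b_i\in\mathbb{Z}[G]$, then the quotient $M/\sum_{i=1}^\ell a_iM^{H_i}$ has finite exponent dividing $d$.
   Context: $N_H=\sum_{h\in H}h$, and $M^H=\{m\in M: hm=m\ \forall h\in H\}$. The relations are equalities in $\mathbb{Z}[G]$. -}

module Defs where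

open import Level using (Level; _⊔_)
open import Data.Nat as ℕ using (ℕ; zero; suc)
open import Data.Integer as ℤ using (ℤ)
open import Data.Fin using (Fin) renaming (zero to fzero; suc to fsuc)
open import Data.Fin.Properties using (_≟_)
open import Data.Fin.Subset using (Subset; _∈_; _∉_)
open import Data.Fin.Subset.Properties using (_∈?_)
open import Data.Product using (Σ; ∃; _×_; _,_)
open import Relation.Nullary using (yes; no)
open import Relation.Binary.PropositionalEquality using (_≡_)
open import Algebra.Bundles using (AbelianGroup)
open import Algebra.Structures using (IsGroup)

-- Finite groups: a group whose underlying set is Fin order
-- (every finite group is isomorphic to one of this form).

record FiniteGroup : Set where
  field
    order   : ℕ
    _∙_     : Fin order → Fin order → Fin order
    ε       : Fin order
    _⁻¹     : Fin order → Fin order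
    isGroup : IsGroup _≡_ _∙_ ε _⁻¹

record Subgroup (G : FiniteGroup) : Set where
  open FiniteGroup G
  field
    carrier : Subset order
    ε∈      : ε ∈ carrier
    ∙-closed : ∀ {x y} → x ∈ carrier → y ∈ carrier → (x ∙ y) ∈ carrier
    ⁻¹-closed : ∀ {x} → x ∈ carrier → (x ⁻¹) ∈ carrier

sumℤ : ∀ {k} → (Fin k → ℤ) → ℤ
sumℤ {zero}  f = ℤ.+ 0
sumℤ {suc k} f = f fzero ℤ.+ sumℤ (λ i → f (fsuc i))

module GroupRing (G : FiniteGroup) where
  open FiniteGroup G

  infix 4 _≋_
  infixl 6 _+ᴳ_
  infixl 7 _*ᴳ_ _·ᴳ_

  ℤ[G] : Set
  ℤ[G] = Fin order → ℤ

  _≋_ : ℤ[G] → ℤ[G] → Set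
  α ≋ β = ∀ g → α g ≡ β g

  _+ᴳ_ : ℤ[G] → ℤ[G] → ℤ[G]
  (α +ᴳ β) g = α g ℤ.+ β g

  _*ᴳ_ : ℤ[G] → ℤ[G] → ℤ[G]
  (α *ᴳ β) g = sumℤ (λ h → α h ℤ.* β ((h ⁻¹) ∙ g))

  δ : Fin order → ℤ[G]
  δ g x with x ≟ g
  ... | yes _ = ℤ.+ 1
  ... | no  _ = ℤ.+ 0

  1ᴳ : ℤ[G]
  1ᴳ = δ ε

  _·ᴳ_ : ℤ → ℤ[G] → ℤ[G]
  (k ·ᴳ α) g = k ℤ.* α g

  N : Subgroup G → ℤ[G]
  N H x with x ∈? Subgroup.carrier H
  ... | yes _ = ℤ.+ 1
  ... | no  _ = ℤ.+ 0

  sumᴳ : ∀ {k} → (Fin k → ℤ[G]) → ℤ[G]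
  sumᴳ f g = sumℤ (λ i → f i g)

record ZGModule (G : FiniteGroup) {c ℓ : Level} (M : AbelianGroup c ℓ)
       : Set (c ⊔ ℓ) where
  open GroupRing G
  open AbelianGroup M renaming (Carrier to Mc)
  field
    _⋆_    : ℤ[G] → Mc → Mc
    ⋆-cong : ∀ {α β x y} → α ≋ β → x ≈ y → (α ⋆ x) ≈ (β ⋆ y)
    ⋆-distribˡ : ∀ α x y → (α ⋆ (x ∙ y)) ≈ ((α ⋆ x) ∙ (α ⋆ y))
    ⋆-distribʳ : ∀ α β x → ((α +ᴳ β) ⋆ x) ≈ ((α ⋆ x) ∙ (β ⋆ x))
    ⋆-assoc : ∀ α β x → ((α *ᴳ β) ⋆ x) ≈ (α ⋆ (β ⋆ x))
    ⋆-identity : ∀ x → (1ᴳ ⋆ x) ≈ x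

module AGOps {c ℓ : Level} (M : AbelianGroup c ℓ) where
  open AbelianGroup M renaming (Carrier to Mc)

  _×ᴹ_ : ℕ → Mc → Mc
  zero  ×ᴹ m = ε
  suc d ×ᴹ m = m ∙ (d ×ᴹ m)

  sumᴹ : ∀ {k} → (Fin k → Mc) → Mc
  sumᴹ {zero}  f = ε
  sumᴹ {suc k} f = f fzero ∙ sumᴹ (λ i → f (fsuc i))

module ModuleNotions (G : FiniteGroup) {c ℓ : Level} (M : AbelianGroup c ℓ)
                     (Mod : ZGModule G M) where
  open FiniteGroup G using (order)
  open GroupRing G
  open AbelianGroup M renaming (Carrier to Mc)
  open AGOps M
  open ZGModule Mod

  Fixed : Subgroup G → Mc → Set ℓ
  Fixed H m = ∀ h → h ∈ Subgroup.carrier H → (δ h ⋆ m) ≈ m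

  InSumFixed : ∀ {k} → (Fin k → Subgroup G) → Mc → Set (c ⊔ ℓ)
  InSumFixed {k} H m =
    Σ (Fin k → Mc) λ ms → (∀ i → Fixed (H i) (ms i)) × (m ≈ sumᴹ ms)

  InSumTwisted : ∀ {k} → (Fin k → ℤ[G]) → (Fin k → Subgroup G) → Mc → Set (c ⊔ ℓ)
  InSumTwisted {k} a H m =
    Σ (Fin k → Mc) λ ms → (∀ i → Fixed (H i) (ms i)) × (m ≈ sumᴹ (λ i → a i ⋆ ms i))

  -- the quotient M / N has finite exponent dividing d, where N is given
  -- by its membership predicate: d annihilates M / N.
  ExponentDivides : ℕ → (Mc → Set (c ⊔ ℓ)) → Set (c ⊔ ℓ)
  ExponentDivides d N = ∀ m → N (d ×ᴹ m)

{-# OPTIONS --safe #-}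
-- If d·1 = Σᵢ fᵢ in ℤ[G], then acting on m gives d·m = Σᵢ fᵢ m. Left multiplication
-- by h ∈ H only shifts the argument of a coefficient function by h⁻¹, and N_H is
-- constant on the cosets Hg, so every element N_H x (and any integer multiple of it) is
-- H-fixed. Writing fᵢ m = aᵢ (N_{Hᵢ} (bᵢ m)) therefore exhibits d·m in Σᵢ aᵢ M^{Hᵢ}.
module Submission where

open import Defs
open import Level using (Level)
open import Data.Nat using (ℕ; _<_; zero; suc)
open import Data.Integer using (ℤ; +_)
import Data.Integer as ℤ
import Data.Integer.Properties as ℤ
open import Data.Fin using (Fin) renaming (zero to fzero; suc to fsuc)
open import Data.Fin.Properties using (_≟_; suc-injective)
open import Data.Fin.Subset using (_∈_; _∉_)
open import Data.Fin.Subset.Properties using (_∈?_)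
open import Data.Product using (_×_; _,_)
open import Data.Empty using (⊥-elim)
open import Relation.Nullary using (yes; no; ¬_)
open import Relation.Binary.PropositionalEquality
  using (_≡_; refl; sym; trans; cong; cong₂; subst; module ≡-Reasoning)
open import Algebra.Bundles using (AbelianGroup)
open import Algebra.Structures using (IsGroup)
import Algebra.Properties.Group as GroupProperties
import Relation.Binary.Reasoning.Setoid as SetoidReasoning

sumℤ-zero : ∀ {k} (f : Fin k → ℤ) → (∀ x → f x ≡ + 0) → sumℤ f ≡ + 0
sumℤ-zero {zero}  f f≡0 = refl
sumℤ-zero {suc k} f f≡0 =
  cong₂ ℤ._+_ (f≡0 fzero) (sumℤ-zero (λ i → f (fsuc i)) (λ i → f≡0 (fsuc i)))

sumℤ-indicator : ∀ {k} (e f : Fin k → ℤ) (p : Fin k) →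
  e p ≡ + 1 → (∀ x → ¬ x ≡ p → e x ≡ + 0) → sumℤ (λ x → e x ℤ.* f x) ≡ f p
sumℤ-indicator {suc k} e f fzero ep≡1 e≡0 = begin
  e fzero ℤ.* f fzero ℤ.+ sumℤ (λ i → e (fsuc i) ℤ.* f (fsuc i))
    ≡⟨ cong₂ ℤ._+_ (trans (cong (ℤ._* f fzero) ep≡1) (ℤ.*-identityˡ (f fzero)))
                   (sumℤ-zero _ (λ i → cong (ℤ._* f (fsuc i)) (e≡0 (fsuc i) (λ ())))) ⟩
  f fzero ℤ.+ + 0
    ≡⟨ ℤ.+-identityʳ (f fzero) ⟩
  f fzero ∎
  where open ≡-Reasoning
sumℤ-indicator {suc k} e f (fsuc p) ep≡1 e≡0 = begin
  e fzero ℤ.* f fzero ℤ.+ sumℤ (λ i → e (fsuc i) ℤ.* f (fsuc i))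
    ≡⟨ cong₂ ℤ._+_ (cong (ℤ._* f fzero) (e≡0 fzero (λ ())))
                   (sumℤ-indicator (λ i → e (fsuc i)) (λ i → f (fsuc i)) p ep≡1
                      (λ x x≢p → e≡0 (fsuc x) (λ eq → x≢p (suc-injective eq)))) ⟩
  + 0 ℤ.+ f (fsuc p)
    ≡⟨ ℤ.+-identityˡ (f (fsuc p)) ⟩
  f (fsuc p) ∎
  where open ≡-Reasoning

module GroupRingProperties (G : FiniteGroup) where
  open FiniteGroup G
  open GroupRing G
  open IsGroup isGroup using (assoc; identityˡ; inverseʳ)

  δ-diagonal : ∀ h → δ h h ≡ + 1
  δ-diagonal h with h ≟ h
  ... | yes _   = refl
  ... | no h≢h  = ⊥-elim (h≢h refl)

  δ-offDiagonal : ∀ h x → ¬ x ≡ h → δ h x ≡ + 0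
  δ-offDiagonal h x x≢h with x ≟ h
  ... | yes x≡h = ⊥-elim (x≢h x≡h)
  ... | no _    = refl

  δ*-apply : ∀ h (α : ℤ[G]) g → (δ h *ᴳ α) g ≡ α ((h ⁻¹) ∙ g)
  δ*-apply h α g = sumℤ-indicator (δ h) (λ x → α ((x ⁻¹) ∙ g)) h (δ-diagonal h) (δ-offDiagonal h)

  -- Pointwise form (via δ*-apply) of h α = α in ℤ[G] for every h ∈ H.
  LeftInvariant : Subgroup G → ℤ[G] → Set
  LeftInvariant H α = ∀ h g → h ∈ Subgroup.carrier H → α ((h ⁻¹) ∙ g) ≡ α g

  ·ᴳ-leftInvariant : ∀ H k {α} → LeftInvariant H α → LeftInvariant H (k ·ᴳ α)
  ·ᴳ-leftInvariant H k inv h g h∈H = cong (k ℤ.*_) (inv h g h∈H)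

  module _ (H : Subgroup G) where
    open Subgroup H

    N-∈ : ∀ x → x ∈ carrier → N H x ≡ + 1
    N-∈ x x∈H with x ∈? carrier
    ... | yes _   = refl
    ... | no x∉H  = ⊥-elim (x∉H x∈H)

    N-∉ : ∀ x → x ∉ carrier → N H x ≡ + 0
    N-∉ x x∉H with x ∈? carrier
    ... | yes x∈H = ⊥-elim (x∉H x∈H)
    ... | no _    = refl

    N-leftInvariant : LeftInvariant H (N H)
    N-leftInvariant h g h∈H with g ∈? carrier
    ... | yes g∈H = N-∈ _ (∙-closed (⁻¹-closed h∈H) g∈H)
    ... | no g∉H  = N-∉ _ (λ h⁻¹g∈H → g∉H (subst (_∈ carrier) h[h⁻¹g]≡g (∙-closed h∈H h⁻¹g∈H)))
      where
      h[h⁻¹g]≡g : h ∙ ((h ⁻¹) ∙ g) ≡ g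
      h[h⁻¹g]≡g = trans (sym (assoc h (h ⁻¹) g)) (trans (cong (_∙ g) (inverseʳ h)) (identityˡ g))

module ModuleProperties (G : FiniteGroup) {c ℓ : Level} (M : AbelianGroup c ℓ) (Mod : ZGModule G M) where
  open GroupRing G
  open GroupRingProperties G
  open ModuleNotions G M Mod
  open AbelianGroup M renaming (Carrier to Mc; refl to ≈-refl; sym to ≈-sym; trans to ≈-trans)
  open AGOps M
  open ZGModule Mod
  open GroupProperties group using (identityʳ-unique)
  open SetoidReasoning setoid

  0ᴳ : ℤ[G]
  0ᴳ _ = + 0

  0ᴳ-⋆ : ∀ m → (0ᴳ ⋆ m) ≈ ε
  0ᴳ-⋆ m = identityʳ-unique (0ᴳ ⋆ m) (0ᴳ ⋆ m)
    (≈-sym (≈-trans (⋆-cong {0ᴳ} {0ᴳ +ᴳ 0ᴳ} (λ _ → refl) ≈-refl) (⋆-distribʳ 0ᴳ 0ᴳ m)))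

  sumᴳ-⋆ : ∀ {k} (f : Fin k → ℤ[G]) m → (sumᴳ f ⋆ m) ≈ sumᴹ (λ i → f i ⋆ m)
  sumᴳ-⋆ {zero}  f m = 0ᴳ-⋆ m
  sumᴳ-⋆ {suc k} f m = begin
    sumᴳ f ⋆ m                                    ≈⟨ ⋆-distribʳ (f fzero) (sumᴳ (λ i → f (fsuc i))) m ⟩
    (f fzero ⋆ m) ∙ (sumᴳ (λ i → f (fsuc i)) ⋆ m) ≈⟨ ∙-congˡ (sumᴳ-⋆ (λ i → f (fsuc i)) m) ⟩
    sumᴹ (λ i → f i ⋆ m)                          ∎

  sumᴹ-cong : ∀ {k} {f g : Fin k → Mc} → (∀ i → f i ≈ g i) → sumᴹ f ≈ sumᴹ g
  sumᴹ-cong {zero}  f≈g = ≈-refl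
  sumᴹ-cong {suc k} f≈g = ∙-cong (f≈g fzero) (sumᴹ-cong (λ i → f≈g (fsuc i)))

  scalar-⋆ : ∀ d m → (((+ d) ·ᴳ 1ᴳ) ⋆ m) ≈ (d ×ᴹ m)
  scalar-⋆ zero    m = 0ᴳ-⋆ m
  scalar-⋆ (suc d) m = begin
    ((+ suc d) ·ᴳ 1ᴳ) ⋆ m           ≈⟨ ⋆-cong [1+d]1≡1+d1 ≈-refl ⟩
    (1ᴳ +ᴳ ((+ d) ·ᴳ 1ᴳ)) ⋆ m       ≈⟨ ⋆-distribʳ 1ᴳ _ m ⟩
    (1ᴳ ⋆ m) ∙ (((+ d) ·ᴳ 1ᴳ) ⋆ m)  ≈⟨ ∙-cong (⋆-identity m) (scalar-⋆ d m) ⟩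
    suc d ×ᴹ m                      ∎
    where
    [1+d]1≡1+d1 : ((+ suc d) ·ᴳ 1ᴳ) ≋ (1ᴳ +ᴳ ((+ d) ·ᴳ 1ᴳ))
    [1+d]1≡1+d1 g = trans (ℤ.*-distribʳ-+ (1ᴳ g) (+ 1) (+ d))
                          (cong (ℤ._+ ((+ d) ℤ.* 1ᴳ g)) (ℤ.*-identityˡ (1ᴳ g)))

  relation-⋆ : ∀ {k} d (f : Fin k → ℤ[G]) → (+ d) ·ᴳ 1ᴳ ≋ sumᴳ f →
    ∀ m → (d ×ᴹ m) ≈ sumᴹ (λ i → f i ⋆ m)
  relation-⋆ d f rel m = begin
    d ×ᴹ m               ≈⟨ ≈-sym (scalar-⋆ d m) ⟩
    ((+ d) ·ᴳ 1ᴳ) ⋆ m    ≈⟨ ⋆-cong rel ≈-refl ⟩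
    sumᴳ f ⋆ m           ≈⟨ sumᴳ-⋆ f m ⟩
    sumᴹ (λ i → f i ⋆ m) ∎

  leftInvariant-⋆-fixed : ∀ H {α} → LeftInvariant H α → ∀ x → Fixed H (α ⋆ x)
  leftInvariant-⋆-fixed H {α} inv x h h∈H = begin
    δ h ⋆ (α ⋆ x)   ≈⟨ ≈-sym (⋆-assoc (δ h) α x) ⟩
    (δ h *ᴳ α) ⋆ x  ≈⟨ ⋆-cong (λ g → trans (δ*-apply h α g) (inv h g h∈H)) ≈-refl ⟩
    α ⋆ x           ∎

  scalarNormRelation⇒ExponentDivides : ∀ (l : ℕ) (H : Fin l → Subgroup G) (d : ℕ) (a : Fin l → ℤ) →
    (+ d) ·ᴳ 1ᴳ ≋ sumᴳ (λ i → a i ·ᴳ N (H i)) → ExponentDivides d (InSumFixed H)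
  scalarNormRelation⇒ExponentDivides l H d a rel m =
    (λ i → (a i ·ᴳ N (H i)) ⋆ m) ,
    (λ i → leftInvariant-⋆-fixed (H i) (·ᴳ-leftInvariant (H i) (a i) (N-leftInvariant (H i))) m) ,
    relation-⋆ d (λ i → a i ·ᴳ N (H i)) rel m

  normRelation⇒ExponentDivides : ∀ (l : ℕ) (H : Fin l → Subgroup G) (d : ℕ) (a b : Fin l → ℤ[G]) →
    (+ d) ·ᴳ 1ᴳ ≋ sumᴳ (λ i → (a i *ᴳ N (H i)) *ᴳ b i) → ExponentDivides d (InSumTwisted a H)
  normRelation⇒ExponentDivides l H d a b rel m =
    (λ i → N (H i) ⋆ (b i ⋆ m)) ,
    (λ i → leftInvariant-⋆-fixed (H i) (N-leftInvariant (H i)) (b i ⋆ m)) ,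
    ≈-trans (relation-⋆ d (λ i → (a i *ᴳ N (H i)) *ᴳ b i) rel m)
            (sumᴹ-cong (λ i → ≈-trans (⋆-assoc _ (b i) m) (⋆-assoc (a i) (N (H i)) _)))

proposition3p1 : (G : FiniteGroup) → ∀ {c ℓ : Level} (M : AbelianGroup c ℓ) (Mod : ZGModule G M) →
    let open GroupRing G
        open ModuleNotions G M Mod
    in
    -- (1) scalar norm relation d = Σ a_i N_{H_i}
    (∀ (l : ℕ) (H : Fin l → Subgroup G) (d : ℕ) (a : Fin l → ℤ) → 0 < d →
      (+ d) ·ᴳ 1ᴳ ≋ sumᴳ (λ i → a i ·ᴳ N (H i)) →
      ExponentDivides d (InSumFixed H))
    ×
    -- (2) norm relation d = Σ a_i N_{H_i} b_i
    (∀ (l : ℕ) (H : Fin l → Subgroup G) (d : ℕ) (a b : Fin l → ℤ[G]) → 0 < d →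
      (+ d) ·ᴳ 1ᴳ ≋ sumᴳ (λ i → (a i *ᴳ N (H i)) *ᴳ b i) →
      ExponentDivides d (InSumTwisted a H))
proposition3p1 G M Mod =
  (λ l H d a _ → scalarNormRelation⇒ExponentDivides l H d a) ,
  (λ l H d a b _ → normRelation⇒ExponentDivides l H d a b)
  where open ModuleProperties G M Mod
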